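{- Let $k\geq 1$. The limit $\lim_{n\to\infty} R_k(n)/k^{2n}$ exists.
   Context: $\Sigma_k=\{0,1,\ldots,k-1\}$ and $\Sigma_k^n$ is the set of length-$n$ words over $\Sigma_k$. For a pair of words $(u,v)$: a right-border is a non-empty word that is a proper suffix of $u$ and a proper prefix of $v$; a left-border is a non-empty word that is a proper prefix of $u$ and a proper suffix of $v$. The pair is right-bordered if it has a right-border but no left-border. $R_k(n)$ is the number of right-bordered pairs $(u,v)\in\Sigma_k^n\times\Sigma_k^n$. -}

module Defs where

open import Data.Nat using (ℕ; zero; suc; _+_; _*_; _^_; _≤_; _<_; NonZero)
open import Data.Nat.Properties using (m^n≢0)
open import Data.Fin using (Fin)
open import Data.Fin.Properties using () renaming (_≟_ to _≟ᶠ_)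
open import Data.List using (List; []; _∷_; length; map; concatMap; filter; upTo; allFin; cartesianProduct)
open import Data.List.Relation.Unary.Any using (Any; any?)
open import Data.List.Relation.Binary.Prefix.Heterogeneous using (Prefix)
open import Data.List.Relation.Binary.Prefix.Heterogeneous.Properties using (prefix?)
open import Data.List.Relation.Binary.Suffix.Heterogeneous using (Suffix)
open import Data.List.Relation.Binary.Suffix.Heterogeneous.Properties using (suffix?)
open import Data.Product using (_×_; _,_; proj₁; proj₂)
open import Relation.Binary.PropositionalEquality using (_≡_; _≢_)
open import Relation.Nullary using (¬_; Dec; yes; no)
open import Relation.Nullary.Decidable using (_×-dec_; ¬?)
import Data.Nat.Properties as ℕP
import Data.Integer as ℤ
open import Data.Rational using (ℚ; _/_)

Word : ℕ → Set
Word k = List (Fin k)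

-- Σ_k^n : all words of length n (a complete, duplicate-free enumeration)
words : (k n : ℕ) → List (Word k)
words k zero    = [] ∷ []
words k (suc n) = concatMap (λ a → map (a ∷_) (words k n)) (allFin k)

IsPrefix : ∀ {k} → Word k → Word k → Set
IsPrefix = Prefix _≡_

IsSuffix : ∀ {k} → Word k → Word k → Set
IsSuffix = Suffix _≡_

IsProperPrefix : ∀ {k} → Word k → Word k → Set
IsProperPrefix w x = IsPrefix w x × length w < length x

IsProperSuffix : ∀ {k} → Word k → Word k → Set
IsProperSuffix w x = IsSuffix w x × length w < length x

IsRightBorder : ∀ {k} → Word k → Word k → Word k → Set
IsRightBorder u v w = w ≢ [] × IsProperSuffix w u × IsProperPrefix w v

IsLeftBorder : ∀ {k} → Word k → Word k → Word k → Set
IsLeftBorder u v w = w ≢ [] × IsProperPrefix w u × IsProperSuffix w v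

-- Candidate borders for a pair in Σ_k^n × Σ_k^n: a proper prefix of a
-- length-n word has length < n, so the candidates are all words of
-- length l for l < n (bounded quantification over the finite set Σ_k^{<n}).
candidates : (k n : ℕ) → List (Word k)
candidates k n = concatMap (words k) (upTo n)

HasRightBorder : (k n : ℕ) → Word k → Word k → Set
HasRightBorder k n u v = Any (IsRightBorder u v) (candidates k n)

HasLeftBorder : (k n : ℕ) → Word k → Word k → Set
HasLeftBorder k n u v = Any (IsLeftBorder u v) (candidates k n)

RightBordered : (k n : ℕ) → Word k × Word k → Set
RightBordered k n (u , v) = HasRightBorder k n u v × ¬ HasLeftBorder k n u v

private
  nonempty? : ∀ {k} (w : Word k) → Dec (w ≢ [])
  nonempty? []      = no (λ f → f Relation.Binary.PropositionalEquality.refl)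
  nonempty? (_ ∷ _) = yes (λ ())

  pp? : ∀ {k} (w x : Word k) → Dec (IsProperPrefix w x)
  pp? w x = prefix? _≟ᶠ_ w x ×-dec (ℕP._<?_ (length w) (length x))

  ps? : ∀ {k} (w x : Word k) → Dec (IsProperSuffix w x)
  ps? w x = suffix? _≟ᶠ_ w x ×-dec (ℕP._<?_ (length w) (length x))

rightBordered? : (k n : ℕ) (p : Word k × Word k) → Dec (RightBordered k n p)
rightBordered? k n (u , v) =
  any? (λ w → nonempty? w ×-dec (ps? w u ×-dec pp? w v)) (candidates k n)
  ×-dec ¬? (any? (λ w → nonempty? w ×-dec (pp? w u ×-dec ps? w v)) (candidates k n))

R : (k n : ℕ) → ℕ
R k n = length (filter (rightBordered? k n) (cartesianProduct (words k n) (words k n)))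

ratio : (k : ℕ) .{{_ : NonZero k}} → ℕ → ℚ
ratio k n = _/_ (ℤ.+ R k n) (k ^ (2 * n)) {{m^n≢0 k (2 * n)}}

module Submission where

-- Call a pair (u, v) of words of length n right-bordered up to M if it has a right-border of
-- length at most M but no left-border of length at most M; for M = n - 1 this is being
-- right-bordered. Borders of length at most M only involve the first and the last M letters of
-- u and v, so for n ≥ 2M the number truncatedR k M n of pairs right-bordered up to M is
-- k^(2(n-2M)) times its value at n = 2M, and its ratio to k^(2n) does not depend on n. A pair
-- on which the two notions disagree has a right- or left-border of some length l > M, and at
-- most k^(2n-l) pairs have a right-border of length l; summing the geometric series, the two
-- counts differ by at most 2k^(2n)/k^M. Hence R_k(n)/k^(2n) varies by at most 4/k^M once
-- n ≥ 2M. For k = 1, every pair of words of length n ≥ 2 has a left-border of length 1, so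
-- R_1(n) = 0.

open import Defs

module Counting where

  open import Data.Bool.Base using (true; false; if_then_else_)
  open import Data.Empty using (⊥-elim)
  open import Data.Fin.Base as Fin using (Fin)
  import Data.Fin.Properties as Fin
  open import Data.List.Base
    using (List; []; _∷_; _++_; map; concatMap; cartesianProduct; filter; upTo; allFin; take; drop; length)
  open import Data.List.Properties
    using ( ≡-dec; upTo-∷ʳ; map-tabulate; length-tabulate; length-take; length-drop
          ; take-take; drop-drop; take++drop≡id)
  open import Data.List.Membership.Propositional using (_∈_; lose)
  open import Data.List.Membership.Propositional.Properties
    using (∈-allFin; ∈-map⁺; ∈-concatMap⁺; ∈-upTo⁺; ∈-upTo⁻)
  open import Data.List.Relation.Binary.Pointwise using (Pointwise-≡⇒≡; ≡⇒Pointwise-≡)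
  open import Data.List.Relation.Binary.Prefix.Heterogeneous using (Prefix; []; _∷_; _++ᵖ_)
  open import Data.List.Relation.Binary.Prefix.Heterogeneous.Properties using (fromPointwise)
  open import Data.List.Relation.Binary.Suffix.Heterogeneous using (Suffix; here; there; _++ˢ_)
  open import Data.List.Relation.Binary.Suffix.Heterogeneous.Properties using (length-mono)
  open import Data.List.Relation.Unary.All as All using (All; []; _∷_)
  open import Data.List.Relation.Unary.All.Properties using (concat⁺; map⁺)
  open import Data.List.Relation.Unary.Any as Any using (here; there; satisfied)
  open import Data.Nat.Base
  open import Data.Nat.Properties
  open import Algebra.Properties.CommutativeSemigroup +-commutativeSemigroup using (interchange)
  open import Algebra.Properties.CommutativeSemigroup *-commutativeSemigroup using (xy∙z≈xz∙y)
  open import Data.Nat.Tactic.RingSolver using (solve-∀)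
  open import Data.Product.Base using (∃; _×_; _,_)
  open import Data.Sum.Base using (_⊎_; inj₁; inj₂; [_,_])
  open import Function.Base using (_∘_; id)
  open import Function.Bundles using (_⇔_; mk⇔; Equivalence)
  open import Relation.Binary.Definitions using (DecidableEquality)
  open import Relation.Binary.PropositionalEquality
    using (_≡_; _≢_; refl; sym; trans; cong; cong₂; subst; module ≡-Reasoning)
  open import Relation.Nullary using (¬_; Dec; yes; no; does)
  open import Relation.Nullary.Decidable using (_×-dec_; ¬?)

  private
    variable
      A B : Set
      xs ys : List A
      f g : A → ℕ

  ∑ : List A → (A → ℕ) → ℕ
  ∑ []       f = 0
  ∑ (x ∷ xs) f = f x + ∑ xs f

  ∑-++ : ∀ (xs ys : List A) f → ∑ (xs ++ ys) f ≡ ∑ xs f + ∑ ys f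
  ∑-++ []       ys f = refl
  ∑-++ (x ∷ xs) ys f = trans (cong (f x +_) (∑-++ xs ys f)) (sym (+-assoc (f x) _ _))

  ∑-map : ∀ (h : B → A) xs f → ∑ (map h xs) f ≡ ∑ xs (f ∘ h)
  ∑-map h []       f = refl
  ∑-map h (x ∷ xs) f = cong (f (h x) +_) (∑-map h xs f)

  ∑-concatMap : ∀ (h : B → List A) xs f → ∑ (concatMap h xs) f ≡ ∑ xs (λ x → ∑ (h x) f)
  ∑-concatMap h []       f = refl
  ∑-concatMap h (x ∷ xs) f = trans (∑-++ (h x) _ f) (cong (∑ (h x) f +_) (∑-concatMap h xs f))

  ∑-cartesianProduct : ∀ (xs : List A) (ys : List B) f →
                       ∑ (cartesianProduct xs ys) f ≡ ∑ xs λ x → ∑ ys λ y → f (x , y)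
  ∑-cartesianProduct []       ys f = refl
  ∑-cartesianProduct (x ∷ xs) ys f = trans (∑-++ (map (x ,_) ys) _ f)
    (cong₂ _+_ (∑-map (x ,_) ys f) (∑-cartesianProduct xs ys f))

  ∑-cong : ∀ (xs : List A) → (∀ {x} → x ∈ xs → f x ≡ g x) → ∑ xs f ≡ ∑ xs g
  ∑-cong []       f≡g = refl
  ∑-cong (x ∷ xs) f≡g = cong₂ _+_ (f≡g (here refl)) (∑-cong xs (f≡g ∘ there))

  ∑-mono : ∀ (xs : List A) → (∀ {x} → x ∈ xs → f x ≤ g x) → ∑ xs f ≤ ∑ xs g
  ∑-mono []       f≤g = z≤n
  ∑-mono (x ∷ xs) f≤g = +-mono-≤ (f≤g (here refl)) (∑-mono xs (f≤g ∘ there))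

  ∑-+ : ∀ (xs : List A) f g → ∑ xs (λ x → f x + g x) ≡ ∑ xs f + ∑ xs g
  ∑-+ []       f g = refl
  ∑-+ (x ∷ xs) f g =
    trans (cong (f x + g x +_) (∑-+ xs f g)) (interchange (f x) (g x) (∑ xs f) (∑ xs g))

  ∑-*ˡ : ∀ (xs : List A) c f → ∑ xs (λ x → c * f x) ≡ c * ∑ xs f
  ∑-*ˡ []       c f = sym (*-zeroʳ c)
  ∑-*ˡ (x ∷ xs) c f = trans (cong (c * f x +_) (∑-*ˡ xs c f)) (sym (*-distribˡ-+ c (f x) _))

  ∑-const : ∀ (xs : List A) c → ∑ xs (λ _ → c) ≡ length xs * c
  ∑-const []       c = refl
  ∑-const (x ∷ xs) c = cong (c +_) (∑-const xs c)

  ∑-zero : ∀ (xs : List A) → ∑ xs (λ _ → 0) ≡ 0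
  ∑-zero xs = trans (∑-const xs 0) (*-zeroʳ (length xs))

  ∑-comm : ∀ (xs : List A) (ys : List B) (h : A → B → ℕ) →
           ∑ xs (λ x → ∑ ys (h x)) ≡ ∑ ys (λ y → ∑ xs (λ x → h x y))
  ∑-comm []       ys h = sym (∑-zero ys)
  ∑-comm (x ∷ xs) ys h =
    trans (cong (∑ ys (h x) +_) (∑-comm xs ys h))
          (sym (∑-+ ys (h x) (λ y → ∑ xs (λ x′ → h x′ y))))

  ∈⇒≤∑ : ∀ {x} → x ∈ xs → f x ≤ ∑ xs f
  ∈⇒≤∑ {xs = y ∷ ys} {f} (here refl) = m≤m+n (f y) _
  ∈⇒≤∑ {xs = y ∷ ys} {f} (there x∈) = ≤-trans (∈⇒≤∑ x∈) (m≤n+m _ (f y))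

  ∑-upTo-suc : ∀ c (f : ℕ → ℕ) → ∑ (upTo (suc c)) f ≡ ∑ (upTo c) f + f c
  ∑-upTo-suc c f = begin
    ∑ (upTo (suc c)) f        ≡⟨ cong (λ l → ∑ l f) (upTo-∷ʳ c) ⟨
    ∑ (upTo c ++ c ∷ []) f    ≡⟨ ∑-++ (upTo c) (c ∷ []) f ⟩
    ∑ (upTo c) f + (f c + 0)  ≡⟨ cong (∑ (upTo c) f +_) (+-identityʳ (f c)) ⟩
    ∑ (upTo c) f + f c        ∎
    where open ≡-Reasoning

  -- Defined through does, so that it computes through the map′ and ×-dec inside the
  -- decidable equalities of Fin and of lists.
  𝟙 : ∀ {P : Set} → Dec P → ℕ
  𝟙 P? = if does P? then 1 else 0

  ∑-𝟙-filter : ∀ {P : A → Set} (P? : ∀ x → Dec (P x)) xs →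
               length (filter P? xs) ≡ ∑ xs (𝟙 ∘ P?)
  ∑-𝟙-filter P? []       = refl
  ∑-𝟙-filter P? (x ∷ xs) with does (P? x)
  ... | true  = cong suc (∑-𝟙-filter P? xs)
  ... | false = ∑-𝟙-filter P? xs

  𝟙-⇔ : ∀ {P Q : Set} → P ⇔ Q → (P? : Dec P) (Q? : Dec Q) → 𝟙 P? ≡ 𝟙 Q?
  𝟙-⇔ P⇔Q (yes p) (yes q) = refl
  𝟙-⇔ P⇔Q (yes p) (no ¬q) = ⊥-elim (¬q (Equivalence.to P⇔Q p))
  𝟙-⇔ P⇔Q (no ¬p) (yes q) = ⊥-elim (¬p (Equivalence.from P⇔Q q))
  𝟙-⇔ P⇔Q (no ¬p) (no ¬q) = refl

  𝟙-yes : ∀ {P : Set} → P → (P? : Dec P) → 𝟙 P? ≡ 1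
  𝟙-yes p (yes _) = refl
  𝟙-yes p (no ¬p) = ⊥-elim (¬p p)

  𝟙-no : ∀ {P : Set} → ¬ P → (P? : Dec P) → 𝟙 P? ≡ 0
  𝟙-no ¬p (yes p) = ⊥-elim (¬p p)
  𝟙-no ¬p (no _)  = refl

  𝟙-≤-+ : ∀ {P Q : Set} {b} → (P → Q ⊎ 1 ≤ b) →
          (P? : Dec P) (Q? : Dec Q) → 𝟙 P? ≤ 𝟙 Q? + b
  𝟙-≤-+ P⇒Q⊎b (no _)  Q? = z≤n
  𝟙-≤-+ P⇒Q⊎b (yes p) Q? with P⇒Q⊎b p
  ... | inj₁ q   = ≤-trans (≤-reflexive (sym (𝟙-yes q Q?))) (m≤m+n (𝟙 Q?) _)
  ... | inj₂ 1≤b = ≤-trans 1≤b (m≤n+m _ (𝟙 Q?))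

  take-++-length : ∀ {l} (x y : List A) → length x ≡ l → take l (x ++ y) ≡ x
  take-++-length []      y refl = refl
  take-++-length (a ∷ x) y refl = cong (a ∷_) (take-++-length x y refl)

  drop-++-length : ∀ {l} (x y : List A) → length x ≡ l → drop l (x ++ y) ≡ y
  drop-++-length []      y refl = refl
  drop-++-length (a ∷ x) y refl = drop-++-length x y refl

  take-take-≤ : ∀ {l m} → l ≤ m → ∀ (xs : List A) → take l (take m xs) ≡ take l xs
  take-take-≤ {l = l} {m} l≤m xs =
    trans (take-take l m xs) (cong (λ t → take t xs) (m≤n⇒m⊓n≡m l≤m))

  length-take-≤ : ∀ {m} (xs : List A) → m ≤ length xs → length (take m xs) ≡ m
  length-take-≤ {m = m} xs m≤|xs| = trans (length-take m xs) (m≤n⇒m⊓n≡m m≤|xs|)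

  prefix⇒≡take : ∀ {w v : List A} → Prefix _≡_ w v → w ≡ take (length w) v
  prefix⇒≡take []         = refl
  prefix⇒≡take (refl ∷ p) = cong (_ ∷_) (prefix⇒≡take p)

  suffix⇒≡drop : ∀ {w u : List A} → Suffix _≡_ w u → w ≡ drop (length u ∸ length w) u
  suffix⇒≡drop {w = w} (here w≋u) with refl ← Pointwise-≡⇒≡ w≋u =
    cong (λ t → drop t w) (sym (n∸n≡0 (length w)))
  suffix⇒≡drop {u = a ∷ u} (there s) =
    trans (suffix⇒≡drop s) (cong (λ t → drop t (a ∷ u)) (sym (+-∸-assoc 1 (length-mono s))))

  take-prefix : ∀ l (v : List A) → Prefix _≡_ (take l v) v
  take-prefix l v =
    subst (Prefix _≡_ (take l v)) (take++drop≡id l v) (fromPointwise (≡⇒Pointwise-≡ refl) ++ᵖ drop l v)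

  drop-suffix : ∀ m (u : List A) → Suffix _≡_ (drop m u) u
  drop-suffix m u =
    subst (Suffix _≡_ (drop m u)) (take++drop≡id m u) (take m u ++ˢ here (≡⇒Pointwise-≡ refl))

  _≟ʷ_ : ∀ {k} → DecidableEquality (Word k)
  _≟ʷ_ = ≡-dec Fin._≟_

  words-length : ∀ k n → All (λ w → length w ≡ n) (words k n)
  words-length k zero    = refl ∷ []
  words-length k (suc n) =
    concat⁺ (map⁺ (All.universal (λ a → map⁺ (All.map (cong suc) (words-length k n))) (allFin k)))

  ∈-words⇒length : ∀ {k n w} → w ∈ words k n → length w ≡ n
  ∈-words⇒length {k} {n} = All.lookup (words-length k n)

  ∈-words : ∀ {k} (w : Word k) → w ∈ words k (length w)
  ∈-words []      = here refl
  ∈-words {k} (a ∷ w) =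
    ∈-concatMap⁺ (λ b → map (b ∷_) (words k (length w)))
                 (lose (∈-allFin a) (∈-map⁺ (a ∷_) (∈-words w)))

  ∑-allFin-suc : ∀ {k} (f : Fin (suc k) → ℕ) →
                 ∑ (allFin (suc k)) f ≡ f Fin.zero + ∑ (allFin k) (f ∘ Fin.suc)
  ∑-allFin-suc {k} f = cong (f Fin.zero +_)
    (trans (cong (λ l → ∑ l f) (sym (map-tabulate id Fin.suc))) (∑-map Fin.suc (allFin k) f))

  ∑-allFin-𝟙≟ : ∀ {k} (b : Fin k) c → ∑ (allFin k) (λ a → 𝟙 (b Fin.≟ a) * c) ≡ c
  ∑-allFin-𝟙≟ {suc k} Fin.zero    c = trans (∑-allFin-suc {k} (λ a → 𝟙 (Fin.zero Fin.≟ a) * c))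
    (trans (cong₂ _+_ (*-identityˡ c) (∑-zero (allFin k))) (+-identityʳ c))
  ∑-allFin-𝟙≟ {suc k} (Fin.suc b) c = trans (∑-allFin-suc {k} (λ a → 𝟙 (Fin.suc b Fin.≟ a) * c))
    (∑-allFin-𝟙≟ b c)

  ∑-words-suc : ∀ k n f →
                ∑ (words k (suc n)) f ≡ ∑ (allFin k) λ a → ∑ (words k n) (f ∘ (a ∷_))
  ∑-words-suc k n f =
    trans (∑-concatMap _ (allFin k) f) (∑-cong (allFin k) λ {a} _ → ∑-map (a ∷_) (words k n) f)

  ∑-words-const : ∀ k n c → ∑ (words k n) (λ _ → c) ≡ k ^ n * c
  ∑-words-const k zero    c = refl
  ∑-words-const k (suc n) c = begin
    ∑ (words k (suc n)) (λ _ → c)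
      ≡⟨ ∑-words-suc k n _ ⟩
    ∑ (allFin k) (λ _ → ∑ (words k n) λ _ → c)
      ≡⟨ ∑-cong (allFin k) (λ _ → ∑-words-const k n c) ⟩
    ∑ (allFin k) (λ _ → k ^ n * c)
      ≡⟨ ∑-const (allFin k) _ ⟩
    length (allFin k) * (k ^ n * c)
      ≡⟨ cong (_* (k ^ n * c)) (length-tabulate {n = k} id) ⟩
    k * (k ^ n * c)
      ≡⟨ *-assoc k (k ^ n) c ⟨
    k ^ suc n * c ∎
    where open ≡-Reasoning

  ∑-words-++ : ∀ k m n f →
               ∑ (words k (m + n)) f ≡ ∑ (words k m) λ x → ∑ (words k n) λ y → f (x ++ y)
  ∑-words-++ k zero    n f = sym (+-identityʳ _)
  ∑-words-++ k (suc m) n f = begin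
    ∑ (words k (suc m + n)) f
      ≡⟨ ∑-words-suc k (m + n) f ⟩
    ∑ (allFin k) (λ a → ∑ (words k (m + n)) (f ∘ (a ∷_)))
      ≡⟨ ∑-cong (allFin k) (λ {a} _ → ∑-words-++ k m n (f ∘ (a ∷_))) ⟩
    ∑ (allFin k) (λ a → ∑ (words k m) λ x → ∑ (words k n) λ y → f (a ∷ x ++ y))
      ≡⟨ ∑-words-suc k m _ ⟨
    ∑ (words k (suc m)) (λ x → ∑ (words k n) λ y → f (x ++ y))
      ∎
    where open ≡-Reasoning

  ∑-words-split : ∀ k {m n l} → m + n ≡ l → ∀ f →
                  ∑ (words k l) f ≡ ∑ (words k m) λ x → ∑ (words k n) λ y → f (x ++ y)
  ∑-words-split k {m} {n} refl = ∑-words-++ k m n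

  𝟙-∷-≟ : ∀ {k} (a b : Fin k) (x y : Word k) →
          𝟙 ((a ∷ x) ≟ʷ (b ∷ y)) ≡ 𝟙 (a Fin.≟ b) * 𝟙 (x ≟ʷ y)
  𝟙-∷-≟ a b x y with does (a Fin.≟ b)
  ... | true  = sym (+-identityʳ _)
  ... | false = refl

  ∑-words-𝟙≟ : ∀ k n (w : Word k) → ∑ (words k n) (λ x → 𝟙 (w ≟ʷ x)) ≤ 1
  ∑-words-𝟙≟ k zero    []      = ≤-refl
  ∑-words-𝟙≟ k zero    (_ ∷ _) = z≤n
  ∑-words-𝟙≟ k (suc n) []      = ≤-trans (≤-reflexive (trans (∑-words-suc k n _)
    (trans (∑-cong (allFin k) (λ _ → ∑-zero (words k n))) (∑-zero (allFin k))))) z≤n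
  ∑-words-𝟙≟ k (suc n) (b ∷ w) = begin
    ∑ (words k (suc n)) (λ x → 𝟙 ((b ∷ w) ≟ʷ x))
      ≡⟨ ∑-words-suc k n _ ⟩
    ∑ (allFin k) (λ a → ∑ (words k n) λ x → 𝟙 ((b ∷ w) ≟ʷ (a ∷ x)))
      ≡⟨ ∑-cong (allFin k) (λ {a} _ → trans (∑-cong (words k n) (λ {x} _ → 𝟙-∷-≟ b a w x))
                                            (∑-*ˡ (words k n) (𝟙 (b Fin.≟ a)) _)) ⟩
    ∑ (allFin k) (λ a → 𝟙 (b Fin.≟ a) * ∑ (words k n) λ x → 𝟙 (w ≟ʷ x))
      ≡⟨ ∑-allFin-𝟙≟ b _ ⟩
    ∑ (words k n) (λ x → 𝟙 (w ≟ʷ x))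
      ≤⟨ ∑-words-𝟙≟ k n w ⟩
    1 ∎
    where open ≤-Reasoning

  ∑-words-𝟙≟take : ∀ k {l n} (w : Word k) → l ≤ n →
                   ∑ (words k n) (λ v → 𝟙 (w ≟ʷ take l v)) ≤ k ^ (n ∸ l)
  ∑-words-𝟙≟take k {l} {n} w l≤n = begin
    ∑ (words k n) (λ v → 𝟙 (w ≟ʷ take l v))
      ≡⟨ ∑-words-split k {l} {n ∸ l} (m+[n∸m]≡n l≤n) _ ⟩
    ∑ (words k l) (λ x → ∑ (words k (n ∸ l)) λ y → 𝟙 (w ≟ʷ take l (x ++ y)))
      ≡⟨ ∑-cong (words k l) (λ {x} x∈ → ∑-cong (words k (n ∸ l)) λ {y} _ →
           cong (λ t → 𝟙 (w ≟ʷ t)) (take-++-length x y (∈-words⇒length x∈))) ⟩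
    ∑ (words k l) (λ x → ∑ (words k (n ∸ l)) λ _ → 𝟙 (w ≟ʷ x))
      ≡⟨ ∑-cong (words k l) (λ {x} _ → ∑-words-const k (n ∸ l) (𝟙 (w ≟ʷ x))) ⟩
    ∑ (words k l) (λ x → k ^ (n ∸ l) * 𝟙 (w ≟ʷ x))
      ≡⟨ ∑-*ˡ (words k l) (k ^ (n ∸ l)) _ ⟩
    k ^ (n ∸ l) * ∑ (words k l) (λ x → 𝟙 (w ≟ʷ x))
      ≤⟨ *-monoʳ-≤ (k ^ (n ∸ l)) (∑-words-𝟙≟ k l w) ⟩
    k ^ (n ∸ l) * 1
      ≡⟨ *-identityʳ _ ⟩
    k ^ (n ∸ l) ∎
    where open ≤-Reasoning

  ∑pairs : ∀ k → ℕ → (Word k → Word k → ℕ) → ℕ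
  ∑pairs k n f = ∑ (words k n) λ u → ∑ (words k n) λ v → f u v

  module _ (k n : ℕ) {f g : Word k → Word k → ℕ} where

    ∑pairs-mono : (∀ {u v} → length u ≡ n → length v ≡ n → f u v ≤ g u v) →
                  ∑pairs k n f ≤ ∑pairs k n g
    ∑pairs-mono f≤g = ∑-mono (words k n) λ u∈ → ∑-mono (words k n) λ v∈ →
      f≤g (∈-words⇒length u∈) (∈-words⇒length v∈)

    ∑pairs-cong : (∀ {u v} → length u ≡ n → length v ≡ n → f u v ≡ g u v) →
                  ∑pairs k n f ≡ ∑pairs k n g
    ∑pairs-cong f≡g = ∑-cong (words k n) λ u∈ → ∑-cong (words k n) λ v∈ →
      f≡g (∈-words⇒length u∈) (∈-words⇒length v∈)

    ∑pairs-+ : ∑pairs k n (λ u v → f u v + g u v) ≡ ∑pairs k n f + ∑pairs k n g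
    ∑pairs-+ = trans (∑-cong (words k n) λ {u} _ → ∑-+ (words k n) (f u) (g u))
                     (∑-+ (words k n) _ _)

  ∑pairs-swap : ∀ k n (f : Word k → Word k → ℕ) → ∑pairs k n (λ u v → f v u) ≡ ∑pairs k n f
  ∑pairs-swap k n f = ∑-comm (words k n) (words k n) (λ u v → f v u)

  ∑pairs-∑ : ∀ k n (xs : List A) (f : A → Word k → Word k → ℕ) →
             ∑pairs k n (λ u v → ∑ xs λ j → f j u v) ≡ ∑ xs λ j → ∑pairs k n (f j)
  ∑pairs-∑ k n xs f =
    trans (∑-cong (words k n) λ {u} _ → ∑-comm (words k n) xs (λ v j → f j u v))
          (∑-comm (words k n) xs (λ u j → ∑ (words k n) (f j u)))

  module _ {k : ℕ} where

    -- The right-borders of length l of a pair (u, v) of words of length n; the left-borders of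
    -- (u, v) are the right-borders of (v, u).
    BorderOfLength : ℕ → ℕ → Word k → Word k → Set
    BorderOfLength n l u v = drop (n ∸ l) u ≡ take l v

    borderOfLength? : ∀ n l (u v : Word k) → Dec (BorderOfLength n l u v)
    borderOfLength? n l u v = drop (n ∸ l) u ≟ʷ take l v

    -- Border lengths 1, …, M are written suc i with i < M, the form decided by anyUpTo?.
    BorderedUpTo : ℕ → ℕ → Word k → Word k → Set
    BorderedUpTo M n u v = ∃ λ i → i < M × BorderOfLength n (suc i) u v

    borderedUpTo? : ∀ M n (u v : Word k) → Dec (BorderedUpTo M n u v)
    borderedUpTo? M n u v = anyUpTo? (λ i → borderOfLength? n (suc i) u v) M

    RightBorderedUpTo : ℕ → ℕ → Word k → Word k → Set
    RightBorderedUpTo M n u v = BorderedUpTo M n u v × ¬ BorderedUpTo M n v u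

    rightBorderedUpTo? : ∀ M n (u v : Word k) → Dec (RightBorderedUpTo M n u v)
    rightBorderedUpTo? M n u v = borderedUpTo? M n u v ×-dec ¬? (borderedUpTo? M n v u)

    module _ {n : ℕ} {u v : Word k} where

      hasRightBorder⇒borderedUpTo : length u ≡ n → HasRightBorder k n u v → BorderedUpTo (pred n) n u v
      hasRightBorder⇒borderedUpTo refl b with satisfied b
      ... | []     , []≢[] , _ = ⊥-elim ([]≢[] refl)
      ... | _ ∷ w′ , _ , (w⊒u , |w|<n) , (w⊑v , _) =
        length w′ , pred-mono-< |w|<n , trans (sym (suffix⇒≡drop w⊒u)) (prefix⇒≡take w⊑v)

      borderedUpTo⇒hasRightBorder : length u ≡ n → length v ≡ n →
                                    BorderedUpTo (pred n) n u v → HasRightBorder k n u v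
      borderedUpTo⇒hasRightBorder |u|≡n |v|≡n (i , i<pred[n] , b) =
        lose w∈candidates (w≢[] , (w⊒u , |w|<|u|) , (take-prefix (suc i) v , |w|<|v|))
        where
        w = take (suc i) v
        1+i<n : suc i < n
        1+i<n = pred-cancel-< i<pred[n]
        |w|≡1+i : length w ≡ suc i
        |w|≡1+i = length-take-≤ v (<⇒≤ (subst (suc i <_) (sym |v|≡n) 1+i<n))
        |w|<n : length w < n
        |w|<n = subst (_< n) (sym |w|≡1+i) 1+i<n
        |w|<|u| : length w < length u
        |w|<|u| = subst (length w <_) (sym |u|≡n) |w|<n
        |w|<|v| : length w < length v
        |w|<|v| = subst (length w <_) (sym |v|≡n) |w|<n
        w≢[] : w ≢ []
        w≢[] w≡[] with () ← trans (sym |w|≡1+i) (cong length w≡[])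
        w⊒u : Suffix _≡_ w u
        w⊒u = subst (λ t → Suffix _≡_ t u) b (drop-suffix (n ∸ suc i) u)
        w∈candidates : w ∈ candidates k n
        w∈candidates = ∈-concatMap⁺ (words k) (lose (∈-upTo⁺ |w|<n) (∈-words w))

    hasLeftBorder⇔ : ∀ {n} {u v : Word k} → HasLeftBorder k n u v ⇔ HasRightBorder k n v u
    hasLeftBorder⇔ = mk⇔ (Any.map λ (w≢[] , w⊑u , w⊒v) → w≢[] , w⊒v , w⊑u)
                         (Any.map λ (w≢[] , w⊒v , w⊑u) → w≢[] , w⊑u , w⊒v)

    rightBordered⇔ : ∀ {n} {u v : Word k} → length u ≡ n → length v ≡ n →
                     RightBordered k n (u , v) ⇔ RightBorderedUpTo (pred n) n u v
    rightBordered⇔ {n} |u|≡n |v|≡n = mk⇔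
      (λ (r , ¬l) → hasRightBorder⇒borderedUpTo |u|≡n r ,
                    ¬l ∘ Equivalence.from (hasLeftBorder⇔ {n})
                       ∘ borderedUpTo⇒hasRightBorder |v|≡n |u|≡n)
      (λ (b , ¬b′) → borderedUpTo⇒hasRightBorder |u|≡n |v|≡n b ,
                     ¬b′ ∘ hasRightBorder⇒borderedUpTo |v|≡n ∘ Equivalence.to (hasLeftBorder⇔ {n}))

    -- Right-borders of the lengths n ∸ j with j < n ∸ M, i.e. in (M, n]; indexing by the shift j
    -- turns the bounds k ^ n * k ^ j of borderCount into a geometric series.
    longBorders : ℕ → ℕ → Word k → Word k → ℕ
    longBorders M n u v = ∑ (upTo (n ∸ M)) λ j → 𝟙 (borderOfLength? n (n ∸ j) u v)

    module _ {M M′ n : ℕ} where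

      borderedUpTo-mono : ∀ {u v} → M ≤ M′ → BorderedUpTo M n u v → BorderedUpTo M′ n u v
      borderedUpTo-mono M≤M′ (i , i<M , b) = i , <-≤-trans i<M M≤M′ , b

      borderedUpTo-split : ∀ {u v} → M′ ≤ n → BorderedUpTo M′ n u v →
                           BorderedUpTo M n u v ⊎ 1 ≤ longBorders M n u v
      borderedUpTo-split {u} {v} M′≤n (i , i<M′ , b) with i <? M
      ... | yes i<M = inj₁ (i , i<M , b)
      ... | no  i≮M = inj₂ (begin
        1                                  ≡⟨ 𝟙-yes b′ (borderOfLength? n (n ∸ j) u v) ⟨
        𝟙 (borderOfLength? n (n ∸ j) u v)  ≤⟨ ∈⇒≤∑ {f = λ j → 𝟙 (borderOfLength? n (n ∸ j) u v)}
                                                    (∈-upTo⁺ j<n∸M) ⟩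
        longBorders M n u v                ∎)
        where
        open ≤-Reasoning
        1+i≤n : suc i ≤ n
        1+i≤n = ≤-trans i<M′ M′≤n
        j = n ∸ suc i
        j<n∸M : j < n ∸ M
        j<n∸M = ∸-monoʳ-< (s≤s (≮⇒≥ i≮M)) 1+i≤n
        b′ : BorderOfLength n (n ∸ j) u v
        b′ = subst (λ l → BorderOfLength n l u v) (sym (m∸[m∸n]≡n 1+i≤n)) b

      module _ (M≤M′ : M ≤ M′) (M′≤n : M′ ≤ n) {u v : Word k} where

        rightBorderedUpTo-shrink : RightBorderedUpTo M′ n u v →
                                   RightBorderedUpTo M n u v ⊎ 1 ≤ longBorders M n u v + longBorders M n v u
        rightBorderedUpTo-shrink (b , ¬b′) with borderedUpTo-split M′≤n b
        ... | inj₁ s   = inj₁ (s , ¬b′ ∘ borderedUpTo-mono M≤M′)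
        ... | inj₂ 1≤l = inj₂ (≤-trans 1≤l (m≤m+n _ _))

        rightBorderedUpTo-grow : RightBorderedUpTo M n u v →
                                 RightBorderedUpTo M′ n u v ⊎ 1 ≤ longBorders M n u v + longBorders M n v u
        rightBorderedUpTo-grow (s , ¬s′) with 1 ≤? longBorders M n u v + longBorders M n v u
        ... | yes 1≤l = inj₂ 1≤l
        ... | no  1≰l = inj₁ (borderedUpTo-mono M≤M′ s ,
                              [ ¬s′ , 1≰l ∘ (λ 1≤l′ → ≤-trans 1≤l′ (m≤n+m _ _)) ]
                              ∘ borderedUpTo-split M′≤n)

  truncatedR : ℕ → ℕ → ℕ → ℕ
  truncatedR k M n = ∑pairs k n λ u v → 𝟙 (rightBorderedUpTo? M n u v)

  longBorderPairs : ℕ → ℕ → ℕ → ℕ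
  longBorderPairs k M n = ∑pairs k n λ u v → longBorders M n u v + longBorders M n v u

  module _ (k : ℕ) {M M′ n : ℕ} (M≤M′ : M ≤ M′) (M′≤n : M′ ≤ n) where

    truncatedR-shrink : truncatedR k M′ n ≤ truncatedR k M n + longBorderPairs k M n
    truncatedR-shrink = ≤-trans
      (∑pairs-mono k n λ {u} {v} _ _ → 𝟙-≤-+ (rightBorderedUpTo-shrink M≤M′ M′≤n)
        (rightBorderedUpTo? M′ n u v) (rightBorderedUpTo? M n u v))
      (≤-reflexive (∑pairs-+ k n))

    truncatedR-grow : truncatedR k M n ≤ truncatedR k M′ n + longBorderPairs k M n
    truncatedR-grow = ≤-trans
      (∑pairs-mono k n λ {u} {v} _ _ → 𝟙-≤-+ (rightBorderedUpTo-grow M≤M′ M′≤n)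
        (rightBorderedUpTo? M n u v) (rightBorderedUpTo? M′ n u v))
      (≤-reflexive (∑pairs-+ k n))

  R≡truncatedR : ∀ k n → R k n ≡ truncatedR k (pred n) n
  R≡truncatedR k n = begin
    R k n
      ≡⟨ ∑-𝟙-filter (rightBordered? k n) (cartesianProduct (words k n) (words k n)) ⟩
    ∑ (cartesianProduct (words k n) (words k n)) (𝟙 ∘ rightBordered? k n)
      ≡⟨ ∑-cartesianProduct (words k n) (words k n) _ ⟩
    ∑pairs k n (λ u v → 𝟙 (rightBordered? k n (u , v)))
      ≡⟨ ∑pairs-cong k n (λ {u} {v} |u|≡n |v|≡n → 𝟙-⇔ (rightBordered⇔ |u|≡n |v|≡n)
           (rightBordered? k n (u , v)) (rightBorderedUpTo? (pred n) n u v)) ⟩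
    truncatedR k (pred n) n
      ∎
    where open ≡-Reasoning

  module _ (k : ℕ) {M n : ℕ} (M<n : M < n) where

    private
      M≤pred[n] : M ≤ pred n
      M≤pred[n] = <⇒≤pred M<n

    R≤truncatedR+longBorderPairs : R k n ≤ truncatedR k M n + longBorderPairs k M n
    R≤truncatedR+longBorderPairs = begin
      R k n                                     ≡⟨ R≡truncatedR k n ⟩
      truncatedR k (pred n) n                   ≤⟨ truncatedR-shrink k {n = n} M≤pred[n] pred[n]≤n ⟩
      truncatedR k M n + longBorderPairs k M n  ∎
      where open ≤-Reasoning

    truncatedR≤R+longBorderPairs : truncatedR k M n ≤ R k n + longBorderPairs k M n
    truncatedR≤R+longBorderPairs = begin
      truncatedR k M n                                 ≤⟨ truncatedR-grow k {n = n} M≤pred[n] pred[n]≤n ⟩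
      truncatedR k (pred n) n + longBorderPairs k M n  ≡⟨ cong (_+ longBorderPairs k M n) (R≡truncatedR k n) ⟨
      R k n + longBorderPairs k M n                    ∎
      where open ≤-Reasoning

  unary-words-≡ : ∀ {x y : Word 1} → length x ≡ length y → x ≡ y
  unary-words-≡ {[]}           {[]}           _ = refl
  unary-words-≡ {Fin.zero ∷ x} {Fin.zero ∷ y} e = cong (Fin.zero ∷_) (unary-words-≡ (suc-injective e))

  R-unary≡0 : ∀ {n} → 2 ≤ n → R 1 n ≡ 0
  R-unary≡0 {n} 2≤n = begin
    R 1 n                    ≡⟨ R≡truncatedR 1 n ⟩
    truncatedR 1 (pred n) n  ≡⟨ ∑pairs-cong 1 n (λ {u} {v} |u|≡n |v|≡n →
                                  𝟙-no (λ (_ , ¬b′) → ¬b′ (bordered |v|≡n |u|≡n))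
                                       (rightBorderedUpTo? (pred n) n u v)) ⟩
    ∑pairs 1 n (λ _ _ → 0)   ≡⟨ trans (∑-cong (words 1 n) (λ _ → ∑-zero (words 1 n)))
                                      (∑-zero (words 1 n)) ⟩
    0                        ∎
    where
    open ≡-Reasoning
    1≤n = ≤-trans (s≤s z≤n) 2≤n
    bordered : ∀ {u v : Word 1} → length u ≡ n → length v ≡ n → BorderedUpTo (pred n) n u v
    bordered {u} {v} |u|≡n |v|≡n = 0 , pred-mono-≤ 2≤n , unary-words-≡ (begin
      length (drop (n ∸ 1) u)  ≡⟨ length-drop (n ∸ 1) u ⟩
      length u ∸ (n ∸ 1)       ≡⟨ cong (_∸ (n ∸ 1)) |u|≡n ⟩
      n ∸ (n ∸ 1)              ≡⟨ m∸[m∸n]≡n 1≤n ⟩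
      1                        ≡⟨ length-take-≤ v (subst (1 ≤_) (sym |v|≡n) 1≤n) ⟨
      length (take 1 v)        ∎)

  borderCount : ∀ k {n l} → l ≤ n →
                ∑pairs k n (λ u v → 𝟙 (borderOfLength? n l u v)) ≤ k ^ n * k ^ (n ∸ l)
  borderCount k {n} {l} l≤n = begin
    ∑pairs k n (λ u v → 𝟙 (borderOfLength? n l u v))
      ≤⟨ ∑-mono (words k n) (λ {u} _ → ∑-words-𝟙≟take k (drop (n ∸ l) u) l≤n) ⟩
    ∑ (words k n) (λ _ → k ^ (n ∸ l))
      ≡⟨ ∑-words-const k n _ ⟩
    k ^ n * k ^ (n ∸ l) ∎
    where open ≤-Reasoning

  ∑-upTo-^ : ∀ {k} → 2 ≤ k → ∀ c → ∑ (upTo c) (k ^_) < k ^ c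
  ∑-upTo-^ 2≤k zero        = s≤s z≤n
  ∑-upTo-^ {k} 2≤k (suc c) = begin-strict
    ∑ (upTo (suc c)) (k ^_)    ≡⟨ ∑-upTo-suc c (k ^_) ⟩
    ∑ (upTo c) (k ^_) + k ^ c  <⟨ +-monoˡ-< (k ^ c) (∑-upTo-^ 2≤k c) ⟩
    k ^ c + k ^ c              ≡⟨ cong (k ^ c +_) (+-identityʳ (k ^ c)) ⟨
    2 * k ^ c                  ≤⟨ *-monoˡ-≤ (k ^ c) 2≤k ⟩
    k ^ suc c                  ∎
    where open ≤-Reasoning

  ^-double : ∀ k n → k ^ (2 * n) ≡ k ^ n * k ^ n
  ^-double k n = trans (^-distribˡ-+-* k n (n + 0)) (cong (λ t → k ^ n * k ^ t) (+-identityʳ n))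

  module _ {k M n : ℕ} (2≤k : 2 ≤ k) (M≤n : M ≤ n) where

    ∑pairs-longBorders-bound : ∑pairs k n (longBorders M n) * k ^ M ≤ k ^ n * k ^ n
    ∑pairs-longBorders-bound = begin
      ∑pairs k n (longBorders M n) * k ^ M
        ≡⟨ cong (_* k ^ M) (∑pairs-∑ k n (upTo (n ∸ M)) _) ⟩
      ∑ (upTo (n ∸ M)) (λ j → ∑pairs k n λ u v → 𝟙 (borderOfLength? n (n ∸ j) u v)) * k ^ M
        ≤⟨ *-monoˡ-≤ (k ^ M) (∑-mono (upTo (n ∸ M)) (shiftCount ∘ ∈-upTo⁻)) ⟩
      ∑ (upTo (n ∸ M)) (λ j → k ^ n * k ^ j) * k ^ M
        ≡⟨ cong (_* k ^ M) (∑-*ˡ (upTo (n ∸ M)) (k ^ n) (k ^_)) ⟩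
      k ^ n * ∑ (upTo (n ∸ M)) (k ^_) * k ^ M
        ≤⟨ *-monoˡ-≤ (k ^ M) (*-monoʳ-≤ (k ^ n) (<⇒≤ (∑-upTo-^ 2≤k (n ∸ M)))) ⟩
      k ^ n * k ^ (n ∸ M) * k ^ M
        ≡⟨ *-assoc (k ^ n) _ _ ⟩
      k ^ n * (k ^ (n ∸ M) * k ^ M)
        ≡⟨ cong (k ^ n *_) (trans (sym (^-distribˡ-+-* k (n ∸ M) M)) (cong (k ^_) (m∸n+n≡m M≤n))) ⟩
      k ^ n * k ^ n ∎
      where
      open ≤-Reasoning
      shiftCount : ∀ {j} → j < n ∸ M →
                   ∑pairs k n (λ u v → 𝟙 (borderOfLength? n (n ∸ j) u v)) ≤ k ^ n * k ^ j
      shiftCount {j} j<n∸M =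
        subst (λ t → ∑pairs k n (λ u v → 𝟙 (borderOfLength? n (n ∸ j) u v)) ≤ k ^ n * k ^ t)
              (m∸[m∸n]≡n j≤n) (borderCount k (m∸n≤m n j))
        where
        j≤n : j ≤ n
        j≤n = ≤-trans (<⇒≤ j<n∸M) (m∸n≤m n M)

    longBorderPairs-bound : longBorderPairs k M n * k ^ M ≤ 2 * k ^ (2 * n)
    longBorderPairs-bound = begin
      longBorderPairs k M n * k ^ M
        ≡⟨ cong (_* k ^ M) (trans (∑pairs-+ k n) (cong (L +_) (∑pairs-swap k n (longBorders M n)))) ⟩
      (L + L) * k ^ M
        ≡⟨ *-distribʳ-+ (k ^ M) L L ⟩
      L * k ^ M + L * k ^ M
        ≤⟨ +-mono-≤ ∑pairs-longBorders-bound ∑pairs-longBorders-bound ⟩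
      k ^ n * k ^ n + k ^ n * k ^ n
        ≡⟨ cong (k ^ n * k ^ n +_) (+-identityʳ (k ^ n * k ^ n)) ⟨
      2 * (k ^ n * k ^ n)
        ≡⟨ cong (2 *_) (^-double k n) ⟨
      2 * k ^ (2 * n) ∎
      where
      open ≤-Reasoning
      L = ∑pairs k n (longBorders M n)

  outer : ∀ {k} → ℕ → ℕ → Word k → Word k
  outer M n u = take M u ++ drop (n ∸ M) u

  module _ {k M n : ℕ} (M≤n : M ≤ n) where

    take-outer : ∀ {l} {v : Word k} → l ≤ M → length v ≡ n → take l (outer M n v) ≡ take l v
    take-outer {l} {v} l≤M |v|≡n = begin
      take l (outer M n v)           ≡⟨ take-take-≤ l≤M (outer M n v) ⟨
      take l (take M (outer M n v))  ≡⟨ cong (take l) (take-++-length (take M v) _ |take[M,v]|≡M) ⟩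
      take l (take M v)              ≡⟨ take-take-≤ l≤M v ⟩
      take l v                       ∎
      where
      open ≡-Reasoning
      |take[M,v]|≡M = length-take-≤ v (subst (M ≤_) (sym |v|≡n) M≤n)

    drop-outer : ∀ {l} {u : Word k} → l ≤ M → length u ≡ n →
                 drop (M + M ∸ l) (outer M n u) ≡ drop (n ∸ l) u
    drop-outer {l} {u} l≤M |u|≡n = begin
      drop (M + M ∸ l) (outer M n u)
        ≡⟨ cong (λ t → drop t (outer M n u)) (+-∸-assoc M l≤M) ⟩
      drop (M + (M ∸ l)) (outer M n u)
        ≡⟨ drop-drop M (M ∸ l) (outer M n u) ⟨
      drop (M ∸ l) (drop M (outer M n u))
        ≡⟨ cong (drop (M ∸ l)) (drop-++-length (take M u) _ |take[M,u]|≡M) ⟩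
      drop (M ∸ l) (drop (n ∸ M) u)
        ≡⟨ drop-drop (n ∸ M) (M ∸ l) u ⟩
      drop (n ∸ M + (M ∸ l)) u
        ≡⟨ cong (λ t → drop t u) n∸M+[M∸l]≡n∸l ⟩
      drop (n ∸ l) u ∎
      where
      open ≡-Reasoning
      |take[M,u]|≡M = length-take-≤ u (subst (M ≤_) (sym |u|≡n) M≤n)
      n∸M+[M∸l]≡n∸l : n ∸ M + (M ∸ l) ≡ n ∸ l
      n∸M+[M∸l]≡n∸l = trans (sym (+-∸-assoc (n ∸ M) l≤M)) (cong (_∸ l) (m∸n+n≡m M≤n))

    module _ {u v : Word k} (|u|≡n : length u ≡ n) (|v|≡n : length v ≡ n) where

      borderedUpTo-outer : BorderedUpTo M (M + M) (outer M n u) (outer M n v) ⇔ BorderedUpTo M n u v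
      borderedUpTo-outer = mk⇔
        (λ (i , i<M , b) → i , i<M , trans (sym (drop-outer i<M |u|≡n)) (trans b (take-outer i<M |v|≡n)))
        (λ (i , i<M , b) → i , i<M , trans (drop-outer i<M |u|≡n) (trans b (sym (take-outer i<M |v|≡n))))

    rightBorderedUpTo-outer : ∀ {u v : Word k} → length u ≡ n → length v ≡ n →
      RightBorderedUpTo M (M + M) (outer M n u) (outer M n v) ⇔ RightBorderedUpTo M n u v
    rightBorderedUpTo-outer {u} {v} |u|≡n |v|≡n = mk⇔
      (λ (b , ¬b′) → to uv b , ¬b′ ∘ from vu)
      (λ (b , ¬b′) → from uv b , ¬b′ ∘ to vu)
      where
      open Equivalence
      uv = borderedUpTo-outer {u} {v} |u|≡n |v|≡n
      vu = borderedUpTo-outer {v} {u} |v|≡n |u|≡n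

  outer-++ : ∀ {k M j} {x y z : Word k} → length x ≡ M → length y ≡ j → length z ≡ M →
             outer M (M + (j + M)) (x ++ (y ++ z)) ≡ x ++ z
  outer-++ {M = M} {j} {x} {y} {z} |x|≡M |y|≡j |z|≡M =
    cong₂ _++_ (take-++-length x (y ++ z) |x|≡M) (begin
      drop (M + (j + M) ∸ M) (x ++ (y ++ z))  ≡⟨ cong (λ t → drop t (x ++ (y ++ z))) n∸M≡M+j ⟩
      drop (M + j) (x ++ (y ++ z))            ≡⟨ drop-drop M j (x ++ (y ++ z)) ⟨
      drop j (drop M (x ++ (y ++ z)))         ≡⟨ cong (drop j) (drop-++-length x (y ++ z) |x|≡M) ⟩
      drop j (y ++ z)                         ≡⟨ drop-++-length y z |y|≡j ⟩
      z                                       ∎)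
    where
    open ≡-Reasoning
    n∸M≡M+j : M + (j + M) ∸ M ≡ M + j
    n∸M≡M+j = trans (m+n∸m≡n M (j + M)) (+-comm j M)

  ∑-words-outer : ∀ k {M j n} → M + (j + M) ≡ n → ∀ (f : Word k → ℕ) →
                  ∑ (words k n) (f ∘ outer M n) ≡ k ^ j * ∑ (words k (M + M)) f
  ∑-words-outer k {M} {j} refl f = begin
    ∑ (W (M + (j + M))) (f ∘ outer M (M + (j + M)))
      ≡⟨ ∑-words-++ k M (j + M) _ ⟩
    ∑ (W M) (λ x → ∑ (W (j + M)) λ r → f (outer M (M + (j + M)) (x ++ r)))
      ≡⟨ ∑-cong (W M) (λ {x} _ → ∑-words-++ k j M _) ⟩
    ∑ (W M) (λ x → ∑ (W j) λ y → ∑ (W M) λ z → f (outer M (M + (j + M)) (x ++ (y ++ z))))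
      ≡⟨ ∑-cong (W M) (λ {x} x∈ → ∑-cong (W j) λ {y} y∈ → ∑-cong (W M) λ {z} z∈ →
           cong f (outer-++ {M = M} {j} {x} {y} {z}
                    (∈-words⇒length x∈) (∈-words⇒length y∈) (∈-words⇒length z∈))) ⟩
    ∑ (W M) (λ x → ∑ (W j) λ _ → ∑ (W M) λ z → f (x ++ z))
      ≡⟨ ∑-cong (W M) (λ {x} _ → ∑-words-const k j (∑ (W M) λ z → f (x ++ z))) ⟩
    ∑ (W M) (λ x → k ^ j * ∑ (W M) λ z → f (x ++ z))
      ≡⟨ ∑-*ˡ (W M) (k ^ j) _ ⟩
    k ^ j * ∑ (W M) (λ x → ∑ (W M) λ z → f (x ++ z))
      ≡⟨ cong (k ^ j *_) (∑-words-++ k M M f) ⟨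
    k ^ j * ∑ (W (M + M)) f ∎
    where
    open ≡-Reasoning
    W = words k

  truncatedR-outer : ∀ k {M j n} → M + (j + M) ≡ n →
                     truncatedR k M n ≡ k ^ j * (k ^ j * truncatedR k M (M + M))
  truncatedR-outer k {M} {j} {n} split = begin
    truncatedR k M n
      ≡⟨ ∑pairs-cong k n (λ {u} {v} |u|≡n |v|≡n →
           sym (𝟙-⇔ (rightBorderedUpTo-outer M≤n |u|≡n |v|≡n)
                    (rightBorderedUpTo? M (M + M) (outer M n u) (outer M n v))
                    (rightBorderedUpTo? M n u v))) ⟩
    ∑ (W n) (λ u → ∑ (W n) λ v → χ (outer M n u) (outer M n v))
      ≡⟨ ∑-cong (W n) (λ {u} _ → ∑-words-outer k {M} {j} split (χ (outer M n u))) ⟩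
    ∑ (W n) (λ u → k ^ j * ∑ (W (M + M)) (χ (outer M n u)))
      ≡⟨ ∑-*ˡ (W n) (k ^ j) _ ⟩
    k ^ j * ∑ (W n) (λ u → ∑ (W (M + M)) (χ (outer M n u)))
      ≡⟨ cong (k ^ j *_) (∑-words-outer k {M} {j} split (λ u′ → ∑ (W (M + M)) (χ u′))) ⟩
    k ^ j * (k ^ j * truncatedR k M (M + M)) ∎
    where
    open ≡-Reasoning
    W = words k
    χ : Word k → Word k → ℕ
    χ u v = 𝟙 (rightBorderedUpTo? M (M + M) u v)
    M≤n : M ≤ n
    M≤n = subst (M ≤_) split (m≤m+n M (j + M))

  truncatedR-scaling : ∀ k {M j n} → M + (j + M) ≡ n →
                       truncatedR k M n * k ^ (2 * (M + M)) ≡ truncatedR k M (M + M) * k ^ (2 * n)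
  truncatedR-scaling k {M} {j} split@refl = begin
    truncatedR k M (M + (j + M)) * E  ≡⟨ cong (_* E) (truncatedR-outer k {M} {j} split) ⟩
    k ^ j * (k ^ j * c) * E           ≡⟨ rearrange (k ^ j) c E ⟩
    c * (k ^ j * k ^ j * E)           ≡⟨ cong (λ t → c * (t * E)) (^-distribˡ-+-* k j j) ⟨
    c * (k ^ (j + j) * E)             ≡⟨ cong (c *_) (^-distribˡ-+-* k (j + j) (2 * (M + M))) ⟨
    c * k ^ (j + j + 2 * (M + M))     ≡⟨ cong (λ t → c * k ^ t) (exponents j M) ⟩
    c * k ^ (2 * (M + (j + M)))       ∎
    where
    open ≡-Reasoning
    c = truncatedR k M (M + M)
    E = k ^ (2 * (M + M))
    rearrange : ∀ a c e → a * (a * c) * e ≡ c * (a * a * e)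
    rearrange = solve-∀
    exponents : ∀ j M → j + j + 2 * (M + M) ≡ 2 * (M + (j + M))
    exponents = solve-∀

  truncatedR-proportional : ∀ k .{{_ : NonZero k}} {M m n} → M + M ≤ m → M + M ≤ n →
                            truncatedR k M m * k ^ (2 * n) ≡ truncatedR k M n * k ^ (2 * m)
  truncatedR-proportional k {M} {m} {n} M+M≤m M+M≤n = *-cancelʳ-≡ _ _ E {{m^n≢0 k (2 * (M + M))}} (begin
    truncatedR k M m * D n * E  ≡⟨ xy∙z≈xz∙y (truncatedR k M m) (D n) E ⟩
    truncatedR k M m * E * D n  ≡⟨ cong (_* D n) (truncatedR-scaling k {M} (split M+M≤m)) ⟩
    c * D m * D n               ≡⟨ xy∙z≈xz∙y c (D m) (D n) ⟩
    c * D n * D m               ≡⟨ cong (_* D m) (truncatedR-scaling k {M} (split M+M≤n)) ⟨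
    truncatedR k M n * E * D m  ≡⟨ xy∙z≈xz∙y (truncatedR k M n) E (D m) ⟩
    truncatedR k M n * D m * E  ∎)
    where
    open ≡-Reasoning
    D : ℕ → ℕ
    D n = k ^ (2 * n)
    E = D (M + M)
    c = truncatedR k M (M + M)
    shuffle : ∀ a b → a + (b + a) ≡ a + a + b
    shuffle = solve-∀
    split : ∀ {n} → M + M ≤ n → M + (n ∸ (M + M) + M) ≡ n
    split {n} M+M≤n = trans (shuffle M (n ∸ (M + M))) (m+[n∸m]≡n M+M≤n)

  sandwich-cross : ∀ {r r′ a a′ b b′ d d′ f} →
                   r ≤ a + b → a′ ≤ r′ + b′ → a * d′ ≡ a′ * d →
                   b * f ≤ 2 * d → b′ * f ≤ 2 * d′ →
                   r * d′ * f ≤ r′ * d * f + 4 * (d * d′)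
  sandwich-cross {r} {r′} {a} {a′} {b} {b′} {d} {d′} {f}
                 r≤a+b a′≤r′+b′ ad′≡a′d bf≤2d b′f≤2d′ = begin
    r * d′ * f
      ≤⟨ *-monoˡ-≤ f (*-monoˡ-≤ d′ r≤a+b) ⟩
    (a + b) * d′ * f
      ≡⟨ distrib a b d′ f ⟩
    a * d′ * f + b * f * d′
      ≤⟨ +-mono-≤ (≤-reflexive (cong (_* f) ad′≡a′d)) (*-monoˡ-≤ d′ bf≤2d) ⟩
    a′ * d * f + 2 * d * d′
      ≤⟨ +-monoˡ-≤ (2 * d * d′) (*-monoˡ-≤ f (*-monoˡ-≤ d a′≤r′+b′)) ⟩
    (r′ + b′) * d * f + 2 * d * d′
      ≡⟨ cong (_+ 2 * d * d′) (distrib r′ b′ d f) ⟩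
    r′ * d * f + b′ * f * d + 2 * d * d′
      ≤⟨ +-monoˡ-≤ (2 * d * d′) (+-monoʳ-≤ (r′ * d * f) (*-monoˡ-≤ d b′f≤2d′)) ⟩
    r′ * d * f + 2 * d′ * d + 2 * d * d′
      ≡⟨ collect (r′ * d * f) d d′ ⟩
    r′ * d * f + 4 * (d * d′) ∎
    where
    open ≤-Reasoning
    distrib : ∀ x y z w → (x + y) * z * w ≡ x * z * w + y * w * z
    distrib = solve-∀
    collect : ∀ x y z → x + 2 * z * y + 2 * y * z ≡ x + 4 * (y * z)
    collect = solve-∀

  R-cross : ∀ k .{{_ : NonZero k}} {M m n} → 2 ≤ k → 0 < M → M + M ≤ m → M + M ≤ n →
            R k m * k ^ (2 * n) * k ^ M ≤ R k n * k ^ (2 * m) * k ^ M + 4 * (k ^ (2 * m) * k ^ (2 * n))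
  R-cross k {M} {m} {n} 2≤k 0<M 2M≤m 2M≤n =
    sandwich-cross {a = truncatedR k M m} {a′ = truncatedR k M n}
                   {b = longBorderPairs k M m} {b′ = longBorderPairs k M n}
      (R≤truncatedR+longBorderPairs k {M} {m} (M< 2M≤m)) (truncatedR≤R+longBorderPairs k {M} {n} (M< 2M≤n))
      (truncatedR-proportional k {M} 2M≤m 2M≤n)
      (longBorderPairs-bound {k} {M} {m} 2≤k (<⇒≤ (M< 2M≤m)))
      (longBorderPairs-bound {k} {M} {n} 2≤k (<⇒≤ (M< 2M≤n)))
    where
    M< : ∀ {n} → M + M ≤ n → M < n
    M< = <-≤-trans (m<m+n M 0<M)

  cross-<-via-slack : ∀ {a b c d e f C F} .{{_ : NonZero d}} .{{_ : NonZero e}} →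
                      a * e * F ≤ b * d * F + C * (d * e) → C * f < c * F →
                      a * (e * f) < (b * f + c * e) * d
  cross-<-via-slack {a} {b} {c} {d} {e} {f} {C} {F} bound C*f<c*F = *-cancelˡ-< F _ _ (begin-strict
    F * (a * (e * f))                    ≡⟨ shuffle₁ F a e f ⟩
    a * e * F * f                        ≤⟨ *-monoˡ-≤ f bound ⟩
    (b * d * F + C * (d * e)) * f        ≡⟨ shuffle₂ b d F C e f ⟩
    F * (b * f * d) + C * f * (d * e)    <⟨ +-monoʳ-< _ (*-monoˡ-< (d * e) {{m*n≢0 d e}} C*f<c*F) ⟩
    F * (b * f * d) + c * F * (d * e)    ≡⟨ shuffle₃ F b f d c e ⟩
    F * ((b * f + c * e) * d)            ∎)
    where
    open ≤-Reasoning
    shuffle₁ : ∀ F a e f → F * (a * (e * f)) ≡ a * e * F * f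
    shuffle₁ = solve-∀
    shuffle₂ : ∀ b d F C e f → (b * d * F + C * (d * e)) * f ≡ F * (b * f * d) + C * f * (d * e)
    shuffle₂ = solve-∀
    shuffle₃ : ∀ F b f d c e → F * (b * f * d) + c * F * (d * e) ≡ F * ((b * f + c * e) * d)
    shuffle₃ = solve-∀

  n<k^n : ∀ {k} → 2 ≤ k → ∀ n → n < k ^ n
  n<k^n 2≤k zero        = s≤s z≤n
  n<k^n {k} 2≤k (suc n) = begin-strict
    suc n          ≤⟨ n<k^n 2≤k n ⟩
    k ^ n          <⟨ m<m+n (k ^ n) (m^n>0 k {{>-nonZero (≤-trans (s≤s z≤n) 2≤k)}} n) ⟩
    k ^ n + k ^ n  ≡⟨ cong (k ^ n +_) (+-identityʳ (k ^ n)) ⟨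
    2 * k ^ n      ≤⟨ *-monoˡ-≤ (k ^ n) 2≤k ⟩
    k ^ suc n      ∎
    where open ≤-Reasoning

open Counting using (R-cross; cross-<-via-slack; R-unary≡0; n<k^n)
open import Data.Integer.Base as ℤ using (+_; +[1+_]; +0; -[1+_]; +<+)
import Data.Integer.Properties as ℤ
open import Data.Nat.Base as ℕ using (ℕ; suc; _^_; _≤_; s≤s; z≤n; NonZero)
import Data.Nat.Properties as ℕ
open import Data.Product.Base using (Σ; ∃₂; _,_)
open import Data.Rational.Base using (ℚ; mkℚ; 0ℚ; _/_; _<_; _+_; _-_; -_; ∣_∣; toℚᵘ; *<*)
open import Data.Rational.Properties
  using ( ↥p/↧p≡p; 0/n≡0; toℚᵘ-fromℚᵘ; toℚᵘ-homo-+; toℚᵘ-cancel-<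
        ; +-monoˡ-<; +-comm; +-assoc; +-inverseʳ; +-identityʳ; ∣p∣≡p∨∣p∣≡-p; +-0-group)
open import Data.Rational.Unnormalised.Base as ℚᵘ using (mkℚᵘ; _≃_)
open import Algebra.Properties.Group +-0-group using (⁻¹-anti-homo-//)
import Data.Rational.Unnormalised.Properties as ℚᵘ
open import Data.Sum.Base using (inj₁; inj₂)
open import Relation.Binary.PropositionalEquality
  using (_≡_; refl; sym; trans; cong; cong₂; subst; subst₂; module ≡-Reasoning)

toℚᵘ-/ : ∀ a d → toℚᵘ (+ a / suc d) ≃ mkℚᵘ (+ a) d
toℚᵘ-/ a d = toℚᵘ-fromℚᵘ (mkℚᵘ (+ a) d)

cross-<⇒a/d<b/e+c/f : ∀ a b c d e f .{{_ : NonZero d}} .{{_ : NonZero e}} .{{_ : NonZero f}} →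
                      a ℕ.* (e ℕ.* f) ℕ.< (b ℕ.* f ℕ.+ c ℕ.* e) ℕ.* d → + a / d < + b / e + + c / f
cross-<⇒a/d<b/e+c/f a b c (suc d) (suc e) (suc f) lt = toℚᵘ-cancel-< (begin-strict
  toℚᵘ (+ a / suc d)                           ≃⟨ toℚᵘ-/ a d ⟩
  mkℚᵘ (+ a) d                                 <⟨ ℚᵘ.*<* (subst₂ ℤ._<_ lhs rhs (+<+ lt)) ⟩
  mkℚᵘ (+ b) e ℚᵘ.+ mkℚᵘ (+ c) f               ≃⟨ ℚᵘ.+-cong (toℚᵘ-/ b e) (toℚᵘ-/ c f) ⟨
  toℚᵘ (+ b / suc e) ℚᵘ.+ toℚᵘ (+ c / suc f)   ≃⟨ toℚᵘ-homo-+ (+ b / suc e) (+ c / suc f) ⟨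
  toℚᵘ (+ b / suc e + + c / suc f)             ∎)
  where
  open ℚᵘ.≤-Reasoning
  lhs = ℤ.pos-* a (suc e ℕ.* suc f)
  rhs = trans (ℤ.pos-* (b ℕ.* suc f ℕ.+ c ℕ.* suc e) (suc d))
          (cong (ℤ._* + suc d) (trans (ℤ.pos-+ (b ℕ.* suc f) (c ℕ.* suc e))
            (cong₂ ℤ._+_ (ℤ.pos-* b (suc f)) (ℤ.pos-* c (suc e)))))

D : ℕ → ℕ → ℕ
D k n = k ^ (2 ℕ.* n)

ratio-<-+ : ∀ k .{{_ : NonZero k}} {m n C F p q} →
            R k m ℕ.* D k n ℕ.* F ≤ R k n ℕ.* D k m ℕ.* F ℕ.+ C ℕ.* (D k m ℕ.* D k n) →
            C ℕ.* suc q ℕ.< suc p ℕ.* F → ratio k m < ratio k n + + suc p / suc q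
ratio-<-+ k {m} {n} {C} {F} {p} {q} bound slack =
  cross-<⇒a/d<b/e+c/f (R k m) (R k n) (suc p) (D k m) (D k n) (suc q) {{D≢0 m}} {{D≢0 n}}
    (cross-<-via-slack {R k m} {R k n} {suc p} {f = suc q} {C} {F} {{D≢0 m}} {{D≢0 n}} bound slack)
  where
  D≢0 : ∀ n → NonZero (D k n)
  D≢0 n = ℕ.m^n≢0 k (2 ℕ.* n)

p<q+r⇒p-q<r : ∀ p q r → p < q + r → p - q < r
p<q+r⇒p-q<r p q r p<q+r = subst (p - q <_) q+r-q≡r (+-monoˡ-< (- q) p<q+r)
  where
  open ≡-Reasoning
  q+r-q≡r : q + r - q ≡ r
  q+r-q≡r = begin
    q + r - q    ≡⟨ cong (_- q) (+-comm q r) ⟩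
    r + q - q    ≡⟨ +-assoc r q (- q) ⟩
    r + (q - q)  ≡⟨ cong (λ t → r + t) (+-inverseʳ q) ⟩
    r + 0ℚ       ≡⟨ +-identityʳ r ⟩
    r            ∎

p<q+r∧q<p+r⇒∣p-q∣<r : ∀ {p q r} → p < q + r → q < p + r → ∣ p - q ∣ < r
p<q+r∧q<p+r⇒∣p-q∣<r {p} {q} {r} p<q+r q<p+r with ∣p∣≡p∨∣p∣≡-p (p - q)
... | inj₁ ∣p-q∣≡p-q = subst (_< r) (sym ∣p-q∣≡p-q) (p<q+r⇒p-q<r p q r p<q+r)
... | inj₂ ∣p-q∣≡-[p-q] =
  subst (_< r) (sym (trans ∣p-q∣≡-[p-q] (⁻¹-anti-homo-// p q))) (p<q+r⇒p-q<r q p r q<p+r)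

positive⇒fraction : ∀ {ε} → 0ℚ < ε → ∃₂ λ p q → ε ≡ + suc p / suc q
positive⇒fraction {ε@(mkℚ +[1+ p ] q _)} _ = p , q , sym (↥p/↧p≡p ε)
positive⇒fraction {mkℚ +0       _ _} (*<* (+<+ ()))
positive⇒fraction {mkℚ -[1+ _ ] _ _} (*<* ())

ratio-unary≡0 : ∀ {n} → 2 ≤ n → ratio 1 n ≡ 0ℚ
ratio-unary≡0 {n} 2≤n =
  trans (cong (λ r → (+ r / D 1 n) {{D≢0}}) (R-unary≡0 2≤n)) (0/n≡0 (D 1 n) {{D≢0}})
  where
  D≢0 = ℕ.m^n≢0 1 (2 ℕ.* n)

corollary11 : (k : ℕ) → .{{_ : NonZero k}} →
    (ε : ℚ) → 0ℚ < ε →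
      Σ ℕ (λ N → (m n : ℕ) → N ≤ m → N ≤ n → ∣ ratio k m - ratio k n ∣ < ε)
corollary11 1 ε 0<ε = 2 , λ m n 2≤m 2≤n →
  subst (_< ε) (sym (cong₂ (λ x y → ∣ x - y ∣) (ratio-unary≡0 2≤m) (ratio-unary≡0 2≤n))) 0<ε
corollary11 k@(suc (suc _)) ε 0<ε with p , q , refl ← positive⇒fraction 0<ε =
  M ℕ.+ M , λ m n 2M≤m 2M≤n → p<q+r∧q<p+r⇒∣p-q∣<r (close 2M≤m 2M≤n) (close 2M≤n 2M≤m)
  where
  M = 4 ℕ.* suc q
  2≤k : 2 ≤ k
  2≤k = s≤s (s≤s z≤n)
  4[1+q]<[1+p]k^M : 4 ℕ.* suc q ℕ.< suc p ℕ.* k ^ M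
  4[1+q]<[1+p]k^M = ℕ.<-≤-trans (n<k^n 2≤k M) (ℕ.m≤n*m (k ^ M) (suc p))
  close : ∀ {m n} → M ℕ.+ M ≤ m → M ℕ.+ M ≤ n → ratio k m < ratio k n + + suc p / suc q
  close {m} {n} 2M≤m 2M≤n =
    ratio-<-+ k {m} {n} {4} {k ^ M} {p} {q} (R-cross k 2≤k (s≤s z≤n) 2M≤m 2M≤n) 4[1+q]<[1+p]k^M
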